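{- Let $(G,\beta)$ be an edge-labeled graph (in the setting described in the context) with vertices $v_1,\dots,v_n$, let $(G_{red},\beta_{red})$ be the graph obtained from $(G,\beta)$ by successively taking reduced graphs associated to the vertices $v_n,v_{n-1},\dots,v_{i+1}$, and let $\psi:\hat R_G\to\hat R_{G_{red}}$, $\psi(f_{v_1},\dots,f_{v_n})=(f_{v_1},\dots,f_{v_i})$. Let $F^{(i)}=(0,\dots,0,f^{(i)}_{v_i},\dots,f^{(i)}_{v_n})$ be an $i$-th flow-up class of $\hat R_G$ (so $f^{(i)}_{v_i}\neq0$ and $f^{(i)}_{v_s}=0$ for $s<i$). Then $F^{(i)}$ is minimal (among $i$-th flow-up classes of $\hat R_G$) if and only if $\psi(F^{(i)})$ is minimal (among $i$-th flow-up classes of $\hat R_{G_{red}}$).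
   Context: Setting: $G$ is a finite connected simple graph. Each vertex $v$ is labeled by $M_v=m_v\mathbb{Z}$ ($m_v\in\mathbb{Z}$), each edge $e$ by $\mathbb{Z}/r_e\mathbb{Z}$ ($r_e\in\mathbb{Z}$). A spline is $f\in\prod_v M_v$ with $f_u-f_v\in r_e\mathbb{Z}$ for every edge $e=uv$; $\hat R_G$ is the $\mathbb{Z}$-module of splines. An $i$-th flow-up class is a spline $F$ with $f_{v_i}\neq0$ and $f_{v_s}=0$ for all $s<i$; its leading term $LT(F)$ is $f_{v_i}$. The leading terms of all $i$-th flow-up classes together with $0$ form an ideal of $\mathbb{Z}$; an $i$-th flow-up class is minimal if its leading term generates this ideal. $(a,b,\dots)$ denotes gcd and $[a,b,\dots]$ lcm. Reduced graph associated to a vertex $v$: (1) delete $v$ and its incident edges; each neighbor $w$ of $v$ is kept with vertex module replaced by $[m_w,(m_v,r_{vw})]\mathbb{Z}$; for each pair of distinct neighbors $w,w'$ of $v$ add an edge $ww'$ labeled $(r_{vw},r_{vw'})$; (2) replace any set of parallel edges with labels $r_1,\dots,r_k$ by a single edge labeled $[r_1,\dots,r_k]$. -}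

module Defs where

open import Data.Nat using (ℕ; zero; suc; _+_; _<_)
open import Data.Fin using (Fin; fromℕ; inject₁; toℕ; _≟_)
open import Data.Bool using (Bool; true; false; _∧_; _∨_; not; if_then_else_)
open import Data.Integer using (ℤ; _-_; 0ℤ)
open import Data.Integer.Divisibility using (_∣_)
open import Data.Integer.GCD using (gcd)
open import Data.Integer.LCM using (lcm)
open import Data.Product using (Σ; _×_; _,_)
open import Data.Sum using (_⊎_)
open import Relation.Nullary using (¬_; does)
open import Relation.Binary.PropositionalEquality using (_≡_)

-- An edge-labeled graph on the vertices v₁,…,vₙ, represented as Fin n
-- (vertex vⱼ is the element of Fin n with toℕ = j - 1).
--   adj u w  : whether uw is an edge
--   lab u w  : the integer r_e of the edge e = uw (edge module ℤ / r_e ℤ)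
--   mod v    : the integer m_v (vertex module m_v ℤ)
record LGraph (n : ℕ) : Set where
  field
    adj : Fin n → Fin n → Bool
    lab : Fin n → Fin n → ℤ
    mod : Fin n → ℤ
open LGraph public

data Reach {n : ℕ} (G : LGraph n) : Fin n → Fin n → Set where
  here : ∀ {u} → Reach G u u
  step : ∀ {u w v} → adj G u w ≡ true → Reach G w v → Reach G u v

record WellFormed {n : ℕ} (G : LGraph n) : Set where
  field
    irrefl    : ∀ u → adj G u u ≡ false
    adj-sym   : ∀ u w → adj G u w ≡ adj G w u
    lab-sym   : ∀ u w → lab G u w ≡ lab G w u
    connected : ∀ u v → Reach G u v

IsSpline : ∀ {n} → LGraph n → (Fin n → ℤ) → Set
IsSpline G f = (∀ v → mod G v ∣ f v)
             × (∀ u w → adj G u w ≡ true → lab G u w ∣ (f u - f w))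

IsFlowUp : ∀ {n} → LGraph n → Fin n → (Fin n → ℤ) → Set
IsFlowUp G i F = IsSpline G F × (¬ (F i ≡ 0ℤ)) × (∀ s → toℕ s < toℕ i → F s ≡ 0ℤ)

InLTIdeal : ∀ {n} → LGraph n → Fin n → ℤ → Set
InLTIdeal G i a = (a ≡ 0ℤ) ⊎ Σ (_ → ℤ) (λ H → IsFlowUp G i H × (H i ≡ a))

-- minimal flow-up class: its leading term generates the ideal
-- (it lies in the ideal, being a flow-up class, and divides every element)
IsMinimalFlowUp : ∀ {n} → LGraph n → Fin n → (Fin n → ℤ) → Set
IsMinimalFlowUp G i F = IsFlowUp G i F × (∀ a → InLTIdeal G i a → F i ∣ a)

reduceLast : ∀ {k} → LGraph (suc k) → LGraph k
reduceLast {k} G = record { adj = adj' ; lab = lab' ; mod = mod' }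
  where
  v : Fin (suc k)
  v = fromℕ k
  ι : Fin k → Fin (suc k)
  ι = inject₁
  nb : Fin k → Bool
  nb w = adj G (ι w) v
  new : Fin k → Fin k → Bool
  new u w = nb u ∧ nb w ∧ not (does (u ≟ w))
  newlab : Fin k → Fin k → ℤ
  newlab u w = gcd (lab G v (ι u)) (lab G v (ι w))
  adj' : Fin k → Fin k → Bool
  adj' u w = adj G (ι u) (ι w) ∨ new u w
  lab' : Fin k → Fin k → ℤ
  lab' u w = if adj G (ι u) (ι w)
               then (if new u w then lcm (lab G (ι u) (ι w)) (newlab u w) else lab G (ι u) (ι w))
               else (if new u w then newlab u w else lab G (ι u) (ι w))
  mod' : Fin k → ℤ
  mod' w = if nb w then lcm (mod G (ι w)) (gcd (mod G v) (lab G v (ι w))) else mod G (ι w)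

reduceN : ∀ d {k} → LGraph (d + k) → LGraph k
reduceN zero    G = G
reduceN (suc d) G = reduceN d (reduceLast G)

embed : ∀ d {k} → Fin k → Fin (d + k)
embed zero    j = j
embed (suc d) j = inject₁ (embed d j)

ψ : ∀ d {k} → (Fin (d + k) → ℤ) → (Fin k → ℤ)
ψ d f j = f (embed d j)

-- Reduce at the last vertex v.  Restricting a spline of G to G - v gives a spline of the
-- reduced graph, since its new conditions gcd(m_v, r_vw) and gcd(r_vu, r_vw) only combine
-- the conditions along the edges through v.  Conversely, a spline g of the reduced graph
-- extends to G by any x with m_v ∣ x and r_vw ∣ x - g_w for all neighbours w of v; those
-- same gcd conditions are the pairwise compatibility of this system of congruences, which
-- the generalized Chinese remainder theorem therefore solves.  Iterating, ψ maps the
-- splines of G onto those of G_red and keeps the entries at v₁,…,vᵢ, so the i-th flow-up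
-- classes of G and of G_red have the same ideal of leading terms.
module Submission where

open import Defs
open import Algebra.Bundles using (CommutativeMonoid)
open import Data.Bool using (Bool; true; false; _∧_; _∨_; not; if_then_else_)
open import Data.Bool.Properties using (∧-commutativeMonoid; ∨-zeroʳ)
open import Data.Fin as Fin using (Fin; zero; suc; fromℕ; fromℕ<; inject₁; toℕ; _≟_)
open import Data.Fin.Properties using (toℕ-inject₁; toℕ-fromℕ<; toℕ-injective; toℕ<n; <⇒≢)
open import Data.Fin.Relation.Unary.Top using (view; ‵fromℕ; ‵inject₁; view-inject₁)
open import Data.Integer as ℤ using (ℤ; +_; _-_; -_; 0ℤ; 1ℤ; ∣_∣; ≢-nonZero)
open import Data.Integer.Properties
  using (pos-+; pos-*; *-cancelʳ-≡; +-comm; +-identityˡ; +-identityʳ; +-inverseʳ)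
open import Data.Integer.Divisibility using () renaming (_∣_ to _∣ᵤ_)
open import Data.Integer.Divisibility.Signed
  using (_∣_; divides; ∣ᵤ⇒∣; ∣⇒∣ᵤ; ∣-refl; ∣-trans; m∣∣m∣; ∣m⇒∣-m; ∣m∣n⇒∣m+n; ∣m+n∣n⇒∣m)
open import Data.Integer.GCD using (gcd; gcd[i,j]∣i; gcd[i,j]∣j; gcd[i,j]≡0⇒i≡0; gcd-comm)
open import Data.Integer.LCM using (lcm; i∣lcm[i,j]; j∣lcm[i,j]; lcm-least)
open import Data.Nat as ℕ using (ℕ; zero; suc; s≤s; z≤n)
open import Data.Nat.Properties using (<-trans)
import Data.Nat.Divisibility as ℕ
import Data.Nat.GCD as ℕ
open import Data.Product using (∃; _×_; _,_; proj₁; proj₂)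
open import Data.Sum using (inj₁; inj₂)
open import Function using (_∘_)
open import Relation.Nullary using (yes; no; does)
open import Relation.Nullary.Decidable using (dec-true; dec-false)
open import Relation.Binary.PropositionalEquality
open ≡-Reasoning

-- Integer _+_ and _*_ are scoped to this block: below, as in the statement, _+_ is ℕ's.
module _ where

  open import Data.Integer using (_+_; _*_)
  open import Data.Integer.Tactic.RingSolver using (solve)
  open import Data.List using (_∷_; [])

  1∣_ : ∀ z → 1ℤ ∣ z
  1∣ z = ∣ᵤ⇒∣ (ℕ.1∣ ∣ z ∣)

  _∣0 : ∀ d → d ∣ 0ℤ
  d ∣0 = ∣ᵤ⇒∣ (∣ d ∣ ℕ.∣0)

  ∣m-n⇒∣n-m : ∀ {d} m n → d ∣ m - n → d ∣ n - m
  ∣m-n⇒∣n-m {d} m n d∣m-n = subst (d ∣_) negate (∣m⇒∣-m d∣m-n)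
    where
    negate : - (m - n) ≡ n - m
    negate = solve (m ∷ n ∷ [])

  ∣m-n∣n-o⇒∣m-o : ∀ {d} m n o → d ∣ m - n → d ∣ n - o → d ∣ m - o
  ∣m-n∣n-o⇒∣m-o {d} m n o p q = subst (d ∣_) telescope (∣m∣n⇒∣m+n p q)
    where
    telescope : (m - n) + (n - o) ≡ m - o
    telescope = solve (m ∷ n ∷ o ∷ [])

  gcd∣ˡ : ∀ a b → gcd a b ∣ a
  gcd∣ˡ a b = ∣ᵤ⇒∣ {gcd a b} {a} (gcd[i,j]∣i a b)

  gcd∣ʳ : ∀ a b → gcd a b ∣ b
  gcd∣ʳ a b = ∣ᵤ⇒∣ {gcd a b} {b} (gcd[i,j]∣j a b)

  infix 4 _∈⟨_,_⟩

  record _∈⟨_,_⟩ (z a b : ℤ) : Set where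
    constructor lincomb
    field
      s t  : ℤ
      z≡as+bt : z ≡ a * s + b * t

  ∈⟨⟩-mono : ∀ {a b a′ b′ z} → a ∣ a′ → b ∣ b′ → z ∈⟨ a′ , b′ ⟩ → z ∈⟨ a , b ⟩
  ∈⟨⟩-mono {a} {b} (divides p refl) (divides q refl) (lincomb s t refl) =
    lincomb (p * s) (q * t) (solve (a ∷ b ∷ p ∷ q ∷ s ∷ t ∷ []))

  gcd∈⟨⟩ : ∀ a b → gcd a b ∈⟨ a , b ⟩
  gcd∈⟨⟩ a b = ∈⟨⟩-mono m∣∣m∣ m∣∣m∣ (ℕ-Bézout ∣ a ∣ ∣ b ∣)
    where
    rearrange : ∀ D Y N X M → D + Y * N ≡ X * M → D ≡ M * X + N * - Y
    rearrange D Y N X M eq = begin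
      D                 ≡⟨ solve (D ∷ Y ∷ N ∷ []) ⟩
      D + Y * N - Y * N ≡⟨ cong (λ c → c - Y * N) eq ⟩
      X * M - Y * N     ≡⟨ solve (X ∷ M ∷ Y ∷ N ∷ []) ⟩
      M * X + N * - Y   ∎

    fromℕ-identity : ∀ d m n x y → d ℕ.+ y ℕ.* n ≡ x ℕ.* m → + d ≡ + m * + x + + n * - + y
    fromℕ-identity d m n x y eq = rearrange (+ d) (+ y) (+ n) (+ x) (+ m) (begin
      + d + + y * + n     ≡⟨ cong (λ c → + d + c) (pos-* y n) ⟨
      + d + + (y ℕ.* n)   ≡⟨ pos-+ d (y ℕ.* n) ⟨
      + (d ℕ.+ y ℕ.* n)   ≡⟨ cong +_ eq ⟩
      + (x ℕ.* m)         ≡⟨ pos-* x m ⟩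
      + x * + m           ∎)

    ℕ-Bézout : ∀ m n → + ℕ.gcd m n ∈⟨ + m , + n ⟩
    ℕ-Bézout m n with ℕ.Bézout.identity (ℕ.gcd-GCD m n)
    ... | ℕ.Bézout.+- x y eq = lincomb (+ x) (- + y) (fromℕ-identity _ m n x y eq)
    ... | ℕ.Bézout.-+ x y eq =
      lincomb (- + x) (+ y) (trans (fromℕ-identity _ n m y x eq) (+-comm (+ n * + y) (+ m * - + x)))

  gcd∣⇒∈⟨⟩ : ∀ {a b z} → gcd a b ∣ z → z ∈⟨ a , b ⟩
  gcd∣⇒∈⟨⟩ {a} {b} (divides k refl) with gcd∈⟨⟩ a b
  ... | lincomb p q eq = lincomb (k * p) (k * q) (begin
    k * gcd a b         ≡⟨ cong (k *_) eq ⟩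
    k * (a * p + b * q) ≡⟨ solve (k ∷ a ∷ b ∷ p ∷ q ∷ []) ⟩
    a * (k * p) + b * (k * q) ∎)

  cofactors-coprime : ∀ {a b a′ b′ g} → g ≢ 0ℤ → g ∈⟨ a , b ⟩ → a ≡ a′ * g → b ≡ b′ * g →
                      1ℤ ∈⟨ a′ , b′ ⟩
  cofactors-coprime {a′ = a′} {b′} {g} g≢0 (lincomb p q eq) refl refl =
    lincomb p q (sym (*-cancelʳ-≡ _ _ g {{≢-nonZero g≢0}} (begin
      (a′ * p + b′ * q) * g       ≡⟨ solve (a′ ∷ b′ ∷ p ∷ q ∷ g ∷ []) ⟩
      a′ * g * p + b′ * g * q     ≡⟨ eq ⟨
      g                           ≡⟨ solve (g ∷ []) ⟩
      1ℤ * g                      ∎)))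

  ∈⟨⟩-∩-cofactors : ∀ {n a′ b′ g z} → 1ℤ ∈⟨ a′ , b′ ⟩ → z ∈⟨ n , a′ * g ⟩ → z ∈⟨ n , b′ * g ⟩ →
                    ∃ λ M → (a′ * g ∣ M) × (b′ * g ∣ M) × z ∈⟨ n , M ⟩
  ∈⟨⟩-∩-cofactors {n} {a′} {b′} {g} {z} (lincomb p q one) (lincomb s₁ t₁ e₁) (lincomb s₂ t₂ e₂) =
    a′ * b′ * g ,
    divides b′ (solve (a′ ∷ b′ ∷ g ∷ [])) ,
    divides a′ (solve (a′ ∷ b′ ∷ g ∷ [])) ,
    lincomb (a′ * p * s₂ + b′ * q * s₁) (p * t₂ + q * t₁) (begin
      z                                ≡⟨ solve (z ∷ []) ⟩
      z * 1ℤ                           ≡⟨ cong (z *_) one ⟩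
      z * (a′ * p + b′ * q)            ≡⟨ solve (z ∷ a′ ∷ b′ ∷ p ∷ q ∷ []) ⟩
      a′ * p * z + b′ * q * z          ≡⟨ cong₂ (λ u w → a′ * p * u + b′ * q * w) e₂ e₁ ⟩
      a′ * p * (n * s₂ + b′ * g * t₂) + b′ * q * (n * s₁ + a′ * g * t₁)
        ≡⟨ solve (n ∷ a′ ∷ b′ ∷ g ∷ p ∷ q ∷ s₁ ∷ s₂ ∷ t₁ ∷ t₂ ∷ []) ⟩
      n * (a′ * p * s₂ + b′ * q * s₁) + a′ * b′ * g * (p * t₂ + q * t₁) ∎)

  -- M = lcm a b: for g = gcd a b ≠ 0 the cofactors a/g and b/g are coprime; g = 0 forces a = 0.
  ∈⟨⟩-∩ : ∀ {n a b z} → z ∈⟨ n , a ⟩ → z ∈⟨ n , b ⟩ → ∃ λ M → (a ∣ M) × (b ∣ M) × z ∈⟨ n , M ⟩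
  ∈⟨⟩-∩ {n} {a} {b} {z} z∈a z∈b
    with gcd a b ℤ.≟ 0ℤ | gcd∣ˡ a b | gcd∣ʳ a b
  ... | yes g≡0 | _ | _ =
    0ℤ , a ∣0 , b ∣0 , subst (λ c → z ∈⟨ n , c ⟩) (gcd[i,j]≡0⇒i≡0 a b g≡0) z∈a
  ... | no g≢0 | divides a′ a≡ | divides b′ b≡ =
    subst₂ CommonMultiple (sym a≡) (sym b≡)
      (∈⟨⟩-∩-cofactors (cofactors-coprime {a′ = a′} {b′} {gcd a b} g≢0 (gcd∈⟨⟩ a b) a≡ b≡)
                       (subst (λ c → z ∈⟨ n , c ⟩) a≡ z∈a) (subst (λ c → z ∈⟨ n , c ⟩) b≡ z∈b))
    where
    CommonMultiple : ℤ → ℤ → Set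
    CommonMultiple a b = ∃ λ M → (a ∣ M) × (b ∣ M) × z ∈⟨ n , M ⟩

  ∈⟨⟩-commonMultiple : ∀ {k n z} (m : Fin k → ℤ) → (∀ j → z ∈⟨ n , m j ⟩) →
                       ∃ λ M → (∀ j → m j ∣ M) × z ∈⟨ n , M ⟩
  ∈⟨⟩-commonMultiple {zero} {n} {z} m _ = 1ℤ , (λ ()) , lincomb 0ℤ z (solve (n ∷ z ∷ []))
  ∈⟨⟩-commonMultiple {suc k} m z∈ with ∈⟨⟩-commonMultiple (m ∘ suc) (z∈ ∘ suc)
  ... | M , m∣M , z∈M with ∈⟨⟩-∩ (z∈ zero) z∈M
  ...   | L , m₀∣L , M∣L , z∈L = L , (λ { zero → m₀∣L ; (suc j) → ∣-trans (m∣M j) M∣L }) , z∈L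

  crt₂ : ∀ {n m} a b → a - b ∈⟨ n , m ⟩ → ∃ λ y → (n ∣ y - a) × (m ∣ y - b)
  crt₂ {n} {m} a b (lincomb s t eq) =
    b + m * t ,
    divides (- s) (begin
      b + m * t - a           ≡⟨ solve (a ∷ b ∷ m ∷ t ∷ []) ⟩
      m * t - (a - b)         ≡⟨ cong (λ c → m * t - c) eq ⟩
      m * t - (n * s + m * t) ≡⟨ solve (n ∷ m ∷ s ∷ t ∷ []) ⟩
      - s * n                 ∎) ,
    divides t (solve (b ∷ m ∷ t ∷ []))

  crt-cons : ∀ {k} (n a : Fin (suc k) → ℤ) →
             (∀ j → gcd (n zero) (n (suc j)) ∣ a zero - a (suc j)) →
             (∃ λ x → ∀ j → n (suc j) ∣ x - a (suc j)) →
             ∃ λ y → ∀ j → n j ∣ y - a j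
  crt-cons n a compatible₀ (x , x-solves) =
    let M , n∣M , a₀-x∈⟨n₀,M⟩ = ∈⟨⟩-commonMultiple (n ∘ suc) (gcd∣⇒∈⟨⟩ ∘ gcd∣a₀-x)
        y , n₀∣y-a₀ , M∣y-x = crt₂ (a zero) x a₀-x∈⟨n₀,M⟩
    in y , λ { zero    → n₀∣y-a₀
             ; (suc j) → ∣m-n∣n-o⇒∣m-o y x (a (suc j)) (∣-trans (n∣M j) M∣y-x) (x-solves j) }
    where
    gcd∣a₀-x : ∀ j → gcd (n zero) (n (suc j)) ∣ a zero - x
    gcd∣a₀-x j = ∣m-n∣n-o⇒∣m-o (a zero) (a (suc j)) x (compatible₀ j)
                   (∣m-n⇒∣n-m x (a (suc j)) (∣-trans (gcd∣ʳ (n zero) (n (suc j))) (x-solves j)))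

  -- Opaque so that type checking never tries to normalise the (Bézout-built) solution.
  opaque
    crt : ∀ {k} (n a : Fin k → ℤ) → (∀ {i j} → i Fin.< j → gcd (n i) (n j) ∣ a i - a j) →
          ∃ λ x → ∀ j → n j ∣ x - a j
    crt {zero} n a _ = 0ℤ , λ ()
    crt {suc k} n a compatible =
      crt-cons n a (λ j → compatible {zero} {suc j} (s≤s z≤n))
        (crt (n ∘ suc) (a ∘ suc) λ {i} {j} i<j → compatible {suc i} {suc j} (s≤s i<j))

-- The part of WellFormed that the argument uses and that reduceLast visibly preserves.
record IsSymmetric {n} (G : LGraph n) : Set where
  field
    adj-sym : ∀ u w → adj G u w ≡ adj G w u
    lab-sym : ∀ u w → lab G u w ≡ lab G w u

WellFormed⇒IsSymmetric : ∀ {n} {G : LGraph n} → WellFormed G → IsSymmetric G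
WellFormed⇒IsSymmetric wf = record
  { adj-sym = WellFormed.adj-sym wf ; lab-sym = WellFormed.lab-sym wf }

∧-≡true : ∀ {a b} → a ∧ b ≡ true → a ≡ true × b ≡ true
∧-≡true {true}  {true}  _ = refl , refl
∧-≡true {true}  {false} ()
∧-≡true {false}         ()

does-≟-comm : ∀ {k} (u w : Fin k) → does (u ≟ w) ≡ does (w ≟ u)
does-≟-comm u w with u ≟ w
... | yes refl = sym (dec-true (u ≟ u) refl)
... | no u≢w   = sym (dec-false (w ≟ u) (u≢w ∘ sym))

-- The shape of the labels of reduceLast G: the lcm of those of r, s whose flag is set
-- (merging parallel edges), and r when neither is.  Vertex modules are the case old = true.
mergeLabels : Bool → ℤ → Bool → ℤ → ℤ
mergeLabels old r new s = if old then (if new then lcm r s else r) else (if new then s else r)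

mergeLabels-least : ∀ old new {r s z} → (old ∨ new) ≡ true →
                    (old ≡ true → r ∣ z) → (new ≡ true → s ∣ z) → mergeLabels old r new s ∣ z
mergeLabels-least true  true  {r} {s} {z} _ r∣z s∣z =
  ∣ᵤ⇒∣ (lcm-least {r} {s} {z} (∣⇒∣ᵤ (r∣z refl)) (∣⇒∣ᵤ (s∣z refl)))
mergeLabels-least true  false _ r∣z _   = r∣z refl
mergeLabels-least false true  _ _   s∣z = s∣z refl

∣-mergeLabelsˡ : ∀ {old} new r s → old ≡ true → r ∣ mergeLabels old r new s
∣-mergeLabelsˡ true  r s refl = ∣ᵤ⇒∣ {r} {lcm r s} (i∣lcm[i,j] r s)
∣-mergeLabelsˡ false r s refl = ∣-refl

∣-mergeLabelsʳ : ∀ old {new} r s → new ≡ true → s ∣ mergeLabels old r new s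
∣-mergeLabelsʳ true  r s refl = ∣ᵤ⇒∣ {s} {lcm r s} (j∣lcm[i,j] r s)
∣-mergeLabelsʳ false r s refl = ∣-refl

mergeLabels-cong : ∀ {old old′ r r′ new new′ s s′} →
                   old ≡ old′ → r ≡ r′ → new ≡ new′ → s ≡ s′ →
                   mergeLabels old r new s ≡ mergeLabels old′ r′ new′ s′
mergeLabels-cong refl refl refl refl = refl

extendLast : ∀ {A : Set} {k} → (Fin k → A) → A → Fin (suc k) → A
extendLast g x i with view i
... | ‵fromℕ     = x
... | ‵inject₁ j = g j

extendLast-inject₁ : ∀ {A : Set} {k} (g : Fin k → A) x j → extendLast g x (inject₁ j) ≡ g j
extendLast-inject₁ g x j rewrite view-inject₁ j = refl

module LastVertex {k : ℕ} (G : LGraph (suc k)) where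

  v : Fin (suc k)
  v = fromℕ k

  ι : Fin k → Fin (suc k)
  ι = inject₁

  G′ : LGraph k
  G′ = reduceLast G

  mv : ℤ
  mv = mod G v

  rv : Fin k → ℤ
  rv w = lab G v (ι w)

  neighbour : Fin k → Bool
  neighbour w = adj G (ι w) v

  viaV : Fin k → Fin k → Bool
  viaV u w = neighbour u ∧ neighbour w ∧ not (does (u ≟ w))

  viaV-comm : ∀ u w → viaV u w ≡ viaV w u
  viaV-comm u w = trans (x∙yz≈y∙xz (neighbour u) (neighbour w) _)
                        (cong (λ b → neighbour w ∧ neighbour u ∧ not b) (does-≟-comm u w))
    where open import Algebra.Properties.CommutativeSemigroup
                        (CommutativeMonoid.commutativeSemigroup ∧-commutativeMonoid)

  viaV-intro : ∀ {u w} → neighbour u ≡ true → neighbour w ≡ true → u ≢ w → viaV u w ≡ true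
  viaV-intro {u} {w} nu nw u≢w rewrite nu | nw | dec-false (u ≟ w) u≢w = refl

  viaV-neighbours : ∀ {u w} → viaV u w ≡ true → neighbour u ≡ true × neighbour w ≡ true
  viaV-neighbours {u} {w} e with ∧-≡true {neighbour u} e
  ... | nu , rest = nu , proj₁ (∧-≡true {neighbour w} rest)

  adj⇒adj′ : ∀ {u w} → adj G (ι u) (ι w) ≡ true → adj G′ u w ≡ true
  adj⇒adj′ {u} {w} e = cong (_∨ viaV u w) e

  viaV⇒adj′ : ∀ {u w} → viaV u w ≡ true → adj G′ u w ≡ true
  viaV⇒adj′ {u} {w} e = trans (cong (adj G (ι u) (ι w) ∨_) e) (∨-zeroʳ _)

  lab∣lab′ : ∀ u w → adj G (ι u) (ι w) ≡ true → lab G (ι u) (ι w) ∣ lab G′ u w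
  lab∣lab′ u w = ∣-mergeLabelsˡ (viaV u w) (lab G (ι u) (ι w)) (gcd (rv u) (rv w))

  gcd∣lab′ : ∀ u w → viaV u w ≡ true → gcd (rv u) (rv w) ∣ lab G′ u w
  gcd∣lab′ u w = ∣-mergeLabelsʳ (adj G (ι u) (ι w)) (lab G (ι u) (ι w)) (gcd (rv u) (rv w))

  lab′-least : ∀ u w {z} → adj G′ u w ≡ true →
               (adj G (ι u) (ι w) ≡ true → lab G (ι u) (ι w) ∣ z) →
               (viaV u w ≡ true → gcd (rv u) (rv w) ∣ z) → lab G′ u w ∣ z
  lab′-least u w = mergeLabels-least (adj G (ι u) (ι w)) (viaV u w)

  mod∣mod′ : ∀ w → mod G (ι w) ∣ mod G′ w
  mod∣mod′ w = ∣-mergeLabelsˡ (neighbour w) (mod G (ι w)) (gcd mv (rv w)) refl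

  gcd∣mod′ : ∀ w → neighbour w ≡ true → gcd mv (rv w) ∣ mod G′ w
  gcd∣mod′ w = ∣-mergeLabelsʳ true (mod G (ι w)) (gcd mv (rv w))

  mod′-least : ∀ w {z} → mod G (ι w) ∣ z →
               (neighbour w ≡ true → gcd mv (rv w) ∣ z) → mod G′ w ∣ z
  mod′-least w m∣z = mergeLabels-least true (neighbour w) refl (λ _ → m∣z)

  reduceLast-isSymmetric : IsSymmetric G → IsSymmetric G′
  reduceLast-isSymmetric G-sym = record
    { adj-sym = λ u w → cong₂ _∨_ (adj-sym (ι u) (ι w)) (viaV-comm u w)
    ; lab-sym = λ u w → mergeLabels-cong (adj-sym (ι u) (ι w)) (lab-sym (ι u) (ι w))
                          (viaV-comm u w) (gcd-comm (rv u) (rv w))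
    }
    where open IsSymmetric G-sym

  restrict : IsSymmetric G → ∀ f → IsSpline G f → IsSpline G′ (f ∘ ι)
  restrict G-sym f (f-mod , f-edge) = ∣⇒∣ᵤ ∘ f-mod′ , λ u w e → ∣⇒∣ᵤ (f-edge′ u w e)
    where
    open IsSymmetric G-sym

    f-edge-v : ∀ w → neighbour w ≡ true → rv w ∣ f (ι w) - f v
    f-edge-v w e = subst (_∣ f (ι w) - f v) (lab-sym (ι w) v) (∣ᵤ⇒∣ (f-edge (ι w) v e))

    f-mod′ : ∀ w → mod G′ w ∣ f (ι w)
    f-mod′ w = mod′-least w (∣ᵤ⇒∣ (f-mod (ι w))) λ e →
      ∣m+n∣n⇒∣m (∣-trans (gcd∣ʳ mv (rv w)) (f-edge-v w e))
                (∣m⇒∣-m (∣-trans (gcd∣ˡ mv (rv w)) (∣ᵤ⇒∣ (f-mod v))))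

    f-edge′ : ∀ u w → adj G′ u w ≡ true → lab G′ u w ∣ f (ι u) - f (ι w)
    f-edge′ u w e = lab′-least u w e (λ e′ → ∣ᵤ⇒∣ (f-edge (ι u) (ι w) e′)) λ via →
      ∣m-n∣n-o⇒∣m-o (f (ι u)) (f v) (f (ι w))
        (∣-trans (gcd∣ˡ (rv u) (rv w)) (f-edge-v u (proj₁ (viaV-neighbours via))))
        (∣m-n⇒∣n-m (f (ι w)) (f v)
          (∣-trans (gcd∣ʳ (rv u) (rv w)) (f-edge-v w (proj₂ (viaV-neighbours via)))))

  -- a non-neighbour of v imposes no condition on the value at v, hence the modulus 1
  moduli : Fin (suc k) → ℤ
  moduli zero    = mv
  moduli (suc w) = if neighbour w then rv w else 1ℤ

  residues : (Fin k → ℤ) → Fin (suc k) → ℤ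
  residues g zero    = 0ℤ
  residues g (suc w) = g w

  compatible : ∀ g → IsSpline G′ g → ∀ {i j} → i Fin.< j →
               gcd (moduli i) (moduli j) ∣ residues g i - residues g j
  compatible g (g-mod , _) {zero} {suc w} _ with neighbour w in nw
  ... | true  = subst (gcd mv (rv w) ∣_) (sym (+-identityˡ (- g w)))
                  (∣m⇒∣-m (∣-trans (gcd∣mod′ w nw) (∣ᵤ⇒∣ (g-mod w))))
  ... | false = ∣-trans (gcd∣ʳ mv 1ℤ) (1∣ _)
  compatible g (_ , g-edge) {suc u} {suc w} (s≤s u<w) with neighbour u in nu | neighbour w in nw
  ... | true  | true  = ∣-trans (gcd∣lab′ u w via) (∣ᵤ⇒∣ (g-edge u w (viaV⇒adj′ via)))
    where
    via : viaV u w ≡ true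
    via = viaV-intro nu nw (<⇒≢ u<w)
  ... | true  | false = ∣-trans (gcd∣ʳ (rv u) 1ℤ) (1∣ _)
  ... | false | b     = ∣-trans (gcd∣ˡ 1ℤ (if b then rv w else 1ℤ)) (1∣ _)

  extendLast-isSpline : IsSymmetric G → ∀ g → IsSpline G′ g →
                        ∀ x → (∀ j → moduli j ∣ x - residues g j) → IsSpline G (extendLast g x)
  extendLast-isSpline G-sym g (g-mod , g-edge) x x-solves = f-mod , f-edge
    where
    open IsSymmetric G-sym

    g-mod′ : ∀ w → mod G′ w ∣ g w
    g-mod′ w = ∣ᵤ⇒∣ (g-mod w)

    g-edge′ : ∀ u w → adj G′ u w ≡ true → lab G′ u w ∣ g u - g w
    g-edge′ u w e = ∣ᵤ⇒∣ (g-edge u w e)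

    x-edge-v : ∀ w → neighbour w ≡ true → rv w ∣ x - g w
    x-edge-v w nw = subst (λ b → (if b then rv w else 1ℤ) ∣ x - g w) nw (x-solves (suc w))

    f-mod : ∀ s → mod G s ∣ᵤ extendLast g x s
    f-mod s with view s
    ... | ‵fromℕ     = ∣⇒∣ᵤ (subst (mv ∣_) (+-identityʳ x) (x-solves zero))
    ... | ‵inject₁ w = ∣⇒∣ᵤ (∣-trans (mod∣mod′ w) (g-mod′ w))

    f-edge : ∀ s t → adj G s t ≡ true → lab G s t ∣ᵤ extendLast g x s - extendLast g x t
    f-edge s t e with view s | view t
    ... | ‵fromℕ     | ‵fromℕ     = ∣⇒∣ᵤ (subst (lab G v v ∣_) (sym (+-inverseʳ x)) (lab G v v ∣0))
    ... | ‵fromℕ     | ‵inject₁ w = ∣⇒∣ᵤ (x-edge-v w (trans (adj-sym (ι w) v) e))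
    ... | ‵inject₁ w | ‵fromℕ     rewrite lab-sym (ι w) v = ∣⇒∣ᵤ (∣m-n⇒∣n-m x (g w) (x-edge-v w e))
    ... | ‵inject₁ u | ‵inject₁ w = ∣⇒∣ᵤ (∣-trans (lab∣lab′ u w e) (g-edge′ u w (adj⇒adj′ e)))

  extend : IsSymmetric G → ∀ g → IsSpline G′ g → ∃ λ f → IsSpline G f × (∀ w → f (ι w) ≡ g w)
  extend G-sym g g-spline with crt moduli (residues g) (compatible g g-spline)
  ... | x , x-solves =
    extendLast g x , extendLast-isSpline G-sym g g-spline x x-solves , extendLast-inject₁ g x

open LastVertex using (reduceLast-isSymmetric; restrict; extend)
open import Data.Nat using (_+_)

ψ-isSpline : ∀ d {k} {G : LGraph (d + k)} → IsSymmetric G → ∀ f → IsSpline G f →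
             IsSpline (reduceN d G) (ψ d f)
ψ-isSpline zero            _     f f-spline = f-spline
ψ-isSpline (suc d) {G = G} G-sym f f-spline =
  ψ-isSpline d (reduceLast-isSymmetric G G-sym) (f ∘ inject₁) (restrict G G-sym f f-spline)

ψ-surjective : ∀ d {k} {G : LGraph (d + k)} → IsSymmetric G → ∀ g → IsSpline (reduceN d G) g →
               ∃ λ f → IsSpline G f × (∀ j → ψ d f j ≡ g j)
ψ-surjective zero            _     g g-spline = g , g-spline , λ _ → refl
ψ-surjective (suc d) {G = G} G-sym g g-spline
  with ψ-surjective d (reduceLast-isSymmetric G G-sym) g g-spline
... | f′ , f′-spline , ψf′≡g with extend G G-sym f′ f′-spline
...   | f , f-spline , f∘inject₁≡f′ =
  f , f-spline , λ j → trans (f∘inject₁≡f′ (embed d j)) (ψf′≡g j)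

toℕ-embed : ∀ d {k} (j : Fin k) → toℕ (embed d j) ≡ toℕ j
toℕ-embed zero    j = refl
toℕ-embed (suc d) j = trans (toℕ-inject₁ (embed d j)) (toℕ-embed d j)

embed-fromℕ< : ∀ d {k} (s : Fin (d + k)) (s<k : toℕ s ℕ.< k) → embed d (fromℕ< s<k) ≡ s
embed-fromℕ< d s s<k = toℕ-injective (trans (toℕ-embed d _) (toℕ-fromℕ< s<k))

ψ-isFlowUp : ∀ d {k} {G : LGraph (d + k)} {F} (j : Fin k) → IsSymmetric G →
             IsFlowUp G (embed d j) F → IsFlowUp (reduceN d G) j (ψ d F)
ψ-isFlowUp d {F = F} j G-sym (F-spline , F≢0 , F-zero) =
  ψ-isSpline d G-sym F F-spline , F≢0 ,
  λ s s<j → F-zero (embed d s) (subst₂ ℕ._<_ (sym (toℕ-embed d s)) (sym (toℕ-embed d j)) s<j)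

ψ-isFlowUp-surjective : ∀ d {k} {G : LGraph (d + k)} {H} (j : Fin k) → IsSymmetric G →
                        IsFlowUp (reduceN d G) j H →
                        ∃ λ F → IsFlowUp G (embed d j) F × ψ d F j ≡ H j
ψ-isFlowUp-surjective d {H = H} j G-sym (H-spline , H≢0 , H-zero)
  with ψ-surjective d G-sym H H-spline
... | F , F-spline , ψF≡H = F , (F-spline , H≢0 ∘ trans (sym (ψF≡H j)) , F-zero) , ψF≡H j
  where
  -- every vertex below vᵢ lies in the image of embed
  F-zero : ∀ s → toℕ s ℕ.< toℕ (embed d j) → F s ≡ 0ℤ
  F-zero s s<embed-j = begin
    F s            ≡⟨ cong F (embed-fromℕ< d s s<k) ⟨
    F (embed d s′) ≡⟨ ψF≡H s′ ⟩
    H s′           ≡⟨ H-zero s′ (subst (ℕ._< toℕ j) (sym (toℕ-fromℕ< s<k)) s<j) ⟩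
    0ℤ             ∎
    where
    s<j : toℕ s ℕ.< toℕ j
    s<j = subst (toℕ s ℕ.<_) (toℕ-embed d j) s<embed-j
    s<k : toℕ s ℕ.< _
    s<k = <-trans s<j (toℕ<n j)
    s′ : Fin _
    s′ = fromℕ< s<k

InLTIdeal-ψ : ∀ d {k} {G : LGraph (d + k)} (j : Fin k) → IsSymmetric G → ∀ {a} →
              InLTIdeal G (embed d j) a → InLTIdeal (reduceN d G) j a
InLTIdeal-ψ d j G-sym (inj₁ a≡0)                   = inj₁ a≡0
InLTIdeal-ψ d j G-sym (inj₂ (F , F-flowUp , LT≡a)) =
  inj₂ (ψ d F , ψ-isFlowUp d j G-sym F-flowUp , LT≡a)

InLTIdeal-ψ⁻¹ : ∀ d {k} {G : LGraph (d + k)} (j : Fin k) → IsSymmetric G → ∀ {a} →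
                InLTIdeal (reduceN d G) j a → InLTIdeal G (embed d j) a
InLTIdeal-ψ⁻¹ d j G-sym (inj₁ a≡0) = inj₁ a≡0
InLTIdeal-ψ⁻¹ d j G-sym (inj₂ (H , H-flowUp , LT≡a)) with ψ-isFlowUp-surjective d j G-sym H-flowUp
... | F , F-flowUp , LT≡ = inj₂ (F , F-flowUp , trans LT≡ LT≡a)

theorem4p7 : (d i : ℕ) (G : LGraph (d + suc i)) → WellFormed G →
    (F : Fin (d + suc i) → ℤ) → IsFlowUp G (embed d (fromℕ i)) F →
    (IsMinimalFlowUp G (embed d (fromℕ i)) F → IsMinimalFlowUp (reduceN d G) (fromℕ i) (ψ d F))
    × (IsMinimalFlowUp (reduceN d G) (fromℕ i) (ψ d F) → IsMinimalFlowUp G (embed d (fromℕ i)) F)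
theorem4p7 d i G wf F F-flowUp =
  (λ (_ , LT∣) → ψ-isFlowUp d j G-sym F-flowUp , λ a → LT∣ a ∘ InLTIdeal-ψ⁻¹ d j G-sym) ,
  (λ (_ , LT∣) → F-flowUp , λ a → LT∣ a ∘ InLTIdeal-ψ d j G-sym)
  where
  G-sym : IsSymmetric G
  G-sym = WellFormed⇒IsSymmetric wf
  j : Fin (suc i)
  j = fromℕ i
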